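{- Let $(G=(V,E),k)$ be an instance of Trivially Perfect Editing to which none of Rules 2, 3, 4, 5 (described in the context) is applicable, i.e. applying any of them would not change the instance. Then every comb $(C,R)$ of $G$ satisfies $|C\cup R|=O(k^2)$.
   Context: A graph is trivially perfect if it has no induced $P_4$ or $C_4$. True twins are vertices with equal closed neighborhoods. A module is a set $M$ with $N_G(u)\setminus M=N_G(v)\setminus M$ for all $u,v\in M$; a trivially perfect module is a module inducing a trivially perfect graph. A critical clique is a maximal set of pairwise true twins. Comb: a pair $(C,R)$ of subsets of $V$ such that $C$ is a clique partitioned into $l$ critical cliques $C_1,\dots,C_l$ of $G$, $R$ is partitioned into $l$ non-empty trivially perfect modules $R_1,\dots,R_l$ with no edges between distinct $R_i$, and: there exist disjoint $V_f,V_p\subseteq V\setminus(C\cup R)$ with $V_f\ne\emptyset$ such that every $x\in C$ has $N_{G\setminus(C\cup R)}(x)=V_p\cup V_f$ and every $y\in R$ has $N_{G\setminus(C\cup R)}(y)=V_p$; and for each $1\le i\le l$, $N_{G[R]}(C_i)=\bigcup_{j=i}^{l}R_j$ and $N_{G[C]}(R_i)=\bigcup_{j=1}^{i}C_j$; $l$ is its length. Rules: Rule 2: if $K$ is a set of true twins with $|K|>k+1$, remove $|K|-(k+1)$ arbitrary vertices of $K$. Rule 3: if $M$ is a trivially perfect module containing an independent set $I$ with $|I|\ge 2k+5$, remove all vertices of $M\setminus I$. Rule 4: for a comb of length $l\ge 2k+2$, remove the vertices of $C_i\cup R_i$ for all $2k+2<i\le l$. Rule 5: for a comb such that there exist $a,b\in\{1,\dots,l\}$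 with $\sum_{a\le i\le l}|R_i|\ge 2k+1$ and $\sum_{b\le i<a}|R_i|\ge 2k+1$, replace each $R_i$, $1\le i\le b-1$, by a clique of size $\min(|R_i|,k+1)$ with the same neighborhood outside it. All rules keep the parameter $k$. -}

module Defs where

open import Data.Nat using (ℕ; zero; suc; _+_; _*_; _^_; _≤_; _<_; _≤ᵇ_; _<ᵇ_)
open import Data.Bool using (Bool; true; false; if_then_else_; _∧_)
open import Data.Fin using (Fin; toℕ)
open import Data.Fin.Subset using (Subset; _∈_; _∉_; _⊆_; _∪_; ∣_∣; ⊥)
open import Data.List using (List; map; allFin; foldr)
open import Data.Nat.ListAction using (sum)
open import Data.Product using (Σ; ∃; ∃-syntax; _×_; _,_)
open import Data.Sum using (_⊎_)
open import Relation.Binary.PropositionalEquality using (_≡_)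
open import Relation.Nullary using (¬_)

record Graph (n : ℕ) : Set where
  field
    adj    : Fin n → Fin n → Bool
    sym    : ∀ u v → adj u v ≡ adj v u
    irrefl : ∀ u → adj u u ≡ false
open Graph public

module _ {n : ℕ} (G : Graph n) where

  Edge : Fin n → Fin n → Set
  Edge u v = adj G u v ≡ true

  NonEdge : Fin n → Fin n → Set
  NonEdge u v = adj G u v ≡ false

  ClosedAdj : Fin n → Fin n → Set
  ClosedAdj u w = (u ≡ w) ⊎ Edge u w

  TrueTwins : Fin n → Fin n → Set
  TrueTwins u v = ∀ w → (ClosedAdj u w → ClosedAdj v w) × (ClosedAdj v w → ClosedAdj u w)

  TwinSet : Subset n → Set
  TwinSet K = ∀ u v → u ∈ K → v ∈ K → TrueTwins u v

  CriticalClique : Subset n → Set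
  CriticalClique K = (∃[ x ] x ∈ K) × TwinSet K
                   × (∀ u v → u ∈ K → TrueTwins u v → v ∈ K)

  IsClique : Subset n → Set
  IsClique K = ∀ u v → u ∈ K → v ∈ K → ¬ (u ≡ v) → Edge u v

  Independent : Subset n → Set
  Independent I = ∀ u v → u ∈ I → v ∈ I → NonEdge u v

  IsModule : Subset n → Set
  IsModule M = ∀ u v w → u ∈ M → v ∈ M → w ∉ M → adj G u w ≡ adj G v w

  InducedP4 : Fin n → Fin n → Fin n → Fin n → Set
  InducedP4 a b c d =
    ¬ a ≡ b × ¬ a ≡ c × ¬ a ≡ d × ¬ b ≡ c × ¬ b ≡ d × ¬ c ≡ d ×
    Edge a b × Edge b c × Edge c d × NonEdge a c × NonEdge b d × NonEdge a d

  InducedC4 : Fin n → Fin n → Fin n → Fin n → Set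
  InducedC4 a b c d =
    ¬ a ≡ b × ¬ a ≡ c × ¬ a ≡ d × ¬ b ≡ c × ¬ b ≡ d × ¬ c ≡ d ×
    Edge a b × Edge b c × Edge c d × Edge d a × NonEdge a c × NonEdge b d

  TriviallyPerfectOn : Subset n → Set
  TriviallyPerfectOn M = ∀ a b c d → a ∈ M → b ∈ M → c ∈ M → d ∈ M →
    ¬ InducedP4 a b c d × ¬ InducedC4 a b c d

  TPModule : Subset n → Set
  TPModule M = IsModule M × TriviallyPerfectOn M

⋃ᶠ : ∀ {n l} → (Fin l → Subset n) → Subset n
⋃ᶠ {n} {l} F = foldr _∪_ ⊥ (map F (allFin l))

pos : ∀ {l} → Fin l → ℕ
pos i = suc (toℕ i)

⋃[_⋯_] : ∀ {n l} → ℕ → ℕ → (Fin l → Subset n) → Subset n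
⋃[_⋯_] {n} {l} lo hi F =
  foldr _∪_ ⊥ (map (λ i → if (lo ≤ᵇ pos i) ∧ (pos i ≤ᵇ hi) then F i else ⊥) (allFin l))

sumRange : ∀ {l} → ℕ → ℕ → (Fin l → ℕ) → ℕ
sumRange {l} lo hi f =
  sum (map (λ i → if (lo ≤ᵇ pos i) ∧ (pos i <ᵇ hi) then f i else 0) (allFin l))

module _ {n : ℕ} (G : Graph n) where

  -- vertices of S adjacent to some vertex of T  (N_{G[S]}(T), used with T ∩ S = ∅)
  NbIn : Subset n → Subset n → Fin n → Set
  NbIn S T w = w ∈ S × ∃[ x ] (x ∈ T × Edge G x w)

  -- A comb (C,R) of length l, with C = C₁ ∪ … ∪ C_l and R = R₁ ∪ … ∪ R_l
  -- (parts indexed by Fin l; part i has 1-based position pos i).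
  record Comb : Set where
    field
      len : ℕ
      Cp  : Fin len → Subset n
      Rp  : Fin len → Subset n
    C : Subset n
    C = ⋃ᶠ Cp
    R : Subset n
    R = ⋃ᶠ Rp
    field
      C-R-disj   : ∀ x → x ∈ C → x ∉ R
      Cp-disj    : ∀ i j x → x ∈ Cp i → x ∈ Cp j → i ≡ j
      Rp-disj    : ∀ i j x → x ∈ Rp i → x ∈ Rp j → i ≡ j
      C-clique   : IsClique G C
      Cp-crit    : ∀ i → CriticalClique G (Cp i)
      Rp-nonempty : ∀ i → ∃[ x ] x ∈ Rp i
      Rp-tpm     : ∀ i → TPModule G (Rp i)
      Rp-noedge  : ∀ i j x y → ¬ i ≡ j → x ∈ Rp i → y ∈ Rp j → NonEdge G x y
      Vf Vp      : Subset n
      Vf-out     : ∀ x → x ∈ Vf → x ∉ C × x ∉ R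
      Vp-out     : ∀ x → x ∈ Vp → x ∉ C × x ∉ R
      Vf-Vp-disj : ∀ x → x ∈ Vf → x ∉ Vp
      Vf-nonempty : ∃[ x ] x ∈ Vf
      C-nbr      : ∀ x w → x ∈ C → w ∉ C → w ∉ R →
                   (Edge G x w → w ∈ Vp ∪ Vf) × (w ∈ Vp ∪ Vf → Edge G x w)
      R-nbr      : ∀ y w → y ∈ R → w ∉ C → w ∉ R →
                   (Edge G y w → w ∈ Vp) × (w ∈ Vp → Edge G y w)
      C-to-R     : ∀ i w → (NbIn R (Cp i) w → w ∈ ⋃[ pos i ⋯ len ] Rp)
                         × (w ∈ ⋃[ pos i ⋯ len ] Rp → NbIn R (Cp i) w)
      R-to-C     : ∀ i w → (NbIn C (Rp i) w → w ∈ ⋃[ 1 ⋯ pos i ] Cp)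
                         × (w ∈ ⋃[ 1 ⋯ pos i ] Cp → NbIn C (Rp i) w)

  open Comb public

  -- Rule 2 does not apply: no set of true twins has more than k+1 vertices.
  Rule2-reduced : ℕ → Set
  Rule2-reduced k = ∀ K → TwinSet G K → ∣ K ∣ ≤ suc k

  -- Rule 3 does not change the instance: whenever M is a trivially perfect
  -- module containing an independent set I with |I| ≥ 2k+5, M \ I is empty.
  Rule3-reduced : ℕ → Set
  Rule3-reduced k = ∀ M I → TPModule G M → I ⊆ M → Independent G I →
    2 * k + 5 ≤ ∣ I ∣ → M ⊆ I

  -- Rule 4 does not change the instance: for every comb of length l ≥ 2k+2,
  -- the parts C_i ∪ R_i with 2k+2 < i ≤ l are empty.
  Rule4-reduced : ℕ → Set
  Rule4-reduced k = ∀ (cb : Comb) → 2 * k + 2 ≤ len cb →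
    ∀ i x → 2 * k + 2 < pos i → x ∉ Cp cb i × x ∉ Rp cb i

  -- Rule 5 does not change the instance: whenever a, b ∈ {1..l} satisfy the
  -- two sum conditions, each R_i with i ≤ b-1 already is a clique of size
  -- min(|R_i|, k+1), i.e. a clique with at most k+1 vertices.
  Rule5-reduced : ℕ → Set
  Rule5-reduced k = ∀ (cb : Comb) (a b : ℕ) →
    1 ≤ a → a ≤ len cb → 1 ≤ b → b ≤ len cb →
    2 * k + 1 ≤ sumRange a (suc (len cb)) (λ i → ∣ Rp cb i ∣) →
    2 * k + 1 ≤ sumRange b a (λ i → ∣ Rp cb i ∣) →
    ∀ i → pos i < b → IsClique G (Rp cb i) × ∣ Rp cb i ∣ ≤ suc k

  Reduced : ℕ → Set
  Reduced k = Rule2-reduced k × Rule3-reduced k × Rule4-reduced k × Rule5-reduced k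

  CR : Comb → Subset n
  CR cb = C cb ∪ R cb

-- Rule 4 bounds the length of a comb by 2k+2 and Rule 2 bounds each critical clique Cᵢ by k+1,
-- so |C| = O(k²).  Each Rᵢ is a trivially perfect module whose sets of true twins have at most
-- k+1 vertices, and such a module S contains an independent set I with |S| + (k+1) ≤ 2(k+1)|I|:
-- the universal vertices of S are pairwise true twins, and in the rest a vertex v of maximum
-- degree has no edge from N[v] to its non-neighbours (it would close an induced P₄ or C₄), which
-- splits S into two smaller trivially perfect modules.  With Rule 3 this gives |Rᵢ| = O(k).
-- Finally let a be the last position with Σ_{i ≥ a} |Rᵢ| ≥ 2k+1 and b the last one with
-- Σ_{b ≤ i < a} |Rᵢ| ≥ 2k+1; both sums are then O(k), and Rule 5 makes every Rᵢ with i < b a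
-- set of at most k+1 vertices, so |R| = O(k²) as well.

module Submission where

open import Defs
open import Data.Nat using (ℕ; suc; _*_; _^_; _≤_)
open import Data.Fin.Subset using (∣_∣)
open import Data.Product using (∃-syntax)

open import Data.Nat using (zero; pred; _+_; _<_; _≤ᵇ_; _<ᵇ_; z≤n; s≤s)
open import Data.Nat.Properties
open import Data.Nat.Tactic.RingSolver using (solve-∀)
open import Data.Bool using (true; false; _∧_; if_then_else_) renaming (_≟_ to _≟ᵇ_)
open import Data.Fin using (Fin; zero; suc; toℕ; fromℕ<)
open import Data.Fin.Properties using (toℕ<n; toℕ-fromℕ<; ¬∀⟶∃¬) renaming (_≟_ to _≟ᶠ_)
open import Data.Fin.Subset
  using (Subset; inside; outside; _∈_; _∉_; _⊆_; _⊂_; _∪_; _∩_; ∁; ⊥; ⁅_⁆; Nonempty; Empty)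
open import Data.Fin.Subset.Properties
open import Data.Fin.Subset.Induction using (⊂-wellFounded; Acc; acc)
open import Data.List using (List; []; _∷_; map; length; tabulate; allFin; foldr)
open import Data.List.Properties using (map-tabulate; length-tabulate)
open import Data.Nat.ListAction using (sum)
open import Data.Vec using ([]; _∷_; here; there)
import Data.Vec as Vec
open import Data.Vec.Properties using (lookup⇒[]=; []=⇒lookup; lookup∘tabulate)
open import Data.Product using (_×_; _,_; proj₁; proj₂)
open import Data.Sum using (_⊎_; inj₁; inj₂)
open import Data.Empty using (⊥-elim) renaming (⊥ to ⊥-type)
open import Function using (id; _∘_)
open import Relation.Binary.PropositionalEquality
  using (_≡_; _≢_; refl; cong; trans; subst; subst₂; module ≡-Reasoning) renaming (sym to ≡-sym)
open import Relation.Nullary using (¬_; yes; no; does; contradiction)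
open import Relation.Nullary.Decidable using (dec-true; _→-dec_; _⊎-dec_)
open import Relation.Nullary.Reflects using (ofʸ; ofⁿ)
open import Relation.Unary using (Pred; Decidable)
open import Algebra.Properties.CommutativeSemigroup +-commutativeSemigroup
  using () renaming (interchange to +-interchange)

module _ {n : ℕ} {ℓ} {P : Pred (Fin n) ℓ} (P? : Decidable P) where

  fromDec : Subset n
  fromDec = Vec.tabulate (does ∘ P?)

  ∈-fromDec⁺ : ∀ {x} → P x → x ∈ fromDec
  ∈-fromDec⁺ {x} px = lookup⇒[]= x fromDec (trans (lookup∘tabulate _ x) (dec-true (P? x) px))

  ∈-fromDec⁻ : ∀ {x} → x ∈ fromDec → P x
  ∈-fromDec⁻ {x} x∈ with P? x | trans (≡-sym (lookup∘tabulate (does ∘ P?) x)) ([]=⇒lookup x∈)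
  ... | yes px | _  = px
  ... | no  _  | ()

⊈⇒∃∉ : ∀ {n} {p q : Subset n} → ¬ p ⊆ q → ∃[ x ] (x ∈ p × x ∉ q)
⊈⇒∃∉ {n} {p} {q} p⊈q with ¬∀⟶∃¬ n _ (λ x → x ∈? p →-dec x ∈? q) (λ p⊆q → p⊈q (p⊆q _))
... | x , x∈p⇏x∈q with x ∈? p
...   | yes x∈p = x , x∈p , λ x∈q → x∈p⇏x∈q (λ _ → x∈q)
...   | no  x∉p = ⊥-elim (x∈p⇏x∈q (λ x∈p → contradiction x∈p x∉p))

∣p∩q∣+∣p∩∁q∣≡∣p∣ : ∀ {n} (p q : Subset n) → ∣ p ∩ q ∣ + ∣ p ∩ ∁ q ∣ ≡ ∣ p ∣
∣p∩q∣+∣p∩∁q∣≡∣p∣ []            []            = refl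
∣p∩q∣+∣p∩∁q∣≡∣p∣ (inside  ∷ p) (inside  ∷ q) = cong suc (∣p∩q∣+∣p∩∁q∣≡∣p∣ p q)
∣p∩q∣+∣p∩∁q∣≡∣p∣ (inside  ∷ p) (outside ∷ q) = trans (+-suc _ _) (cong suc (∣p∩q∣+∣p∩∁q∣≡∣p∣ p q))
∣p∩q∣+∣p∩∁q∣≡∣p∣ (outside ∷ p) (_       ∷ q) = ∣p∩q∣+∣p∩∁q∣≡∣p∣ p q

∣p∪q∣≤∣p∣+∣q∣ : ∀ {n} (p q : Subset n) → ∣ p ∪ q ∣ ≤ ∣ p ∣ + ∣ q ∣
∣p∪q∣≤∣p∣+∣q∣ []            []            = z≤n
∣p∪q∣≤∣p∣+∣q∣ (inside  ∷ p) (inside  ∷ q) =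
  s≤s (≤-trans (∣p∪q∣≤∣p∣+∣q∣ p q) (+-monoʳ-≤ ∣ p ∣ (n≤1+n _)))
∣p∪q∣≤∣p∣+∣q∣ (inside  ∷ p) (outside ∷ q) = s≤s (∣p∪q∣≤∣p∣+∣q∣ p q)
∣p∪q∣≤∣p∣+∣q∣ (outside ∷ p) (inside  ∷ q) =
  subst (suc ∣ p ∪ q ∣ ≤_) (≡-sym (+-suc ∣ p ∣ ∣ q ∣)) (s≤s (∣p∪q∣≤∣p∣+∣q∣ p q))
∣p∪q∣≤∣p∣+∣q∣ (outside ∷ p) (outside ∷ q) = ∣p∪q∣≤∣p∣+∣q∣ p q

∣p∣+∣q∣≤∣p∪q∣ : ∀ {n} (p q : Subset n) → Empty (p ∩ q) → ∣ p ∣ + ∣ q ∣ ≤ ∣ p ∪ q ∣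
∣p∣+∣q∣≤∣p∪q∣ []            []            _    = z≤n
∣p∣+∣q∣≤∣p∪q∣ (inside  ∷ p) (inside  ∷ q) disj = contradiction (zero , here) disj
∣p∣+∣q∣≤∣p∪q∣ (inside  ∷ p) (outside ∷ q) disj = s≤s (∣p∣+∣q∣≤∣p∪q∣ p q (drop-∷-Empty disj))
∣p∣+∣q∣≤∣p∪q∣ (outside ∷ p) (inside  ∷ q) disj =
  subst (_≤ suc ∣ p ∪ q ∣) (≡-sym (+-suc ∣ p ∣ ∣ q ∣)) (s≤s (∣p∣+∣q∣≤∣p∪q∣ p q (drop-∷-Empty disj)))
∣p∣+∣q∣≤∣p∪q∣ (outside ∷ p) (outside ∷ q) disj = ∣p∣+∣q∣≤∣p∪q∣ p q (drop-∷-Empty disj)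

⊆-ofSize : ∀ {n} (p : Subset n) m → m ≤ ∣ p ∣ → ∃[ q ] (q ⊆ p × ∣ q ∣ ≡ m)
⊆-ofSize {n} p         zero    _ = ⊥ , ⊥⊆ , ∣⊥∣≡0 n
⊆-ofSize (outside ∷ p) (suc m) m<∣p∣ with ⊆-ofSize p (suc m) m<∣p∣
... | q , q⊆p , ∣q∣≡ = outside ∷ q , (λ { (there x∈q) → there (q⊆p x∈q) }) , ∣q∣≡
⊆-ofSize (inside  ∷ p) (suc m) (s≤s m≤∣p∣) with ⊆-ofSize p m m≤∣p∣
... | q , q⊆p , ∣q∣≡ = inside ∷ q , (λ { here → here ; (there x∈q) → there (q⊆p x∈q) }) , cong suc ∣q∣≡

argmax : ∀ {n} (f : Fin n → ℕ) (p : Subset n) →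
         Empty p ⊎ ∃[ v ] (v ∈ p × ∀ {y} → y ∈ p → f y ≤ f v)
argmax f []      = inj₁ λ { (() , _) }
argmax f (s ∷ p) with argmax (f ∘ suc) p | s
... | inj₁ empty | outside = inj₁ λ { (suc y , there y∈p) → empty (y , y∈p) }
... | inj₁ empty | inside  =
  inj₂ (zero , here , λ { here → ≤-refl ; (there y∈p) → ⊥-elim (empty (_ , y∈p)) })
... | inj₂ (v , v∈p , max) | outside = inj₂ (suc v , there v∈p , λ { (there y∈p) → max y∈p })
... | inj₂ (v , v∈p , max) | inside with f zero ≤? f (suc v)
...   | yes f₀≤ = inj₂ (suc v , there v∈p , λ { here → f₀≤ ; (there y∈p) → max y∈p })
...   | no  f₀≰ =
  inj₂ (zero , here , λ { here → ≤-refl ; (there y∈p) → ≤-trans (max y∈p) (<⇒≤ (≰⇒> f₀≰)) })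

module _ {a} {A : Set a} where

  sum-map-mono : ∀ {F G : A → ℕ} (xs : List A) → (∀ x → F x ≤ G x) → sum (map F xs) ≤ sum (map G xs)
  sum-map-mono []       _    = z≤n
  sum-map-mono (x ∷ xs) F≤G = +-mono-≤ (F≤G x) (sum-map-mono xs F≤G)

  sum-map-+ : ∀ (F G : A → ℕ) (xs : List A) →
              sum (map (λ x → F x + G x) xs) ≡ sum (map F xs) + sum (map G xs)
  sum-map-+ F G []       = refl
  sum-map-+ F G (x ∷ xs) = begin
    (F x + G x) + sum (map (λ x → F x + G x) xs)   ≡⟨ cong (F x + G x +_) (sum-map-+ F G xs) ⟩
    (F x + G x) + (sum (map F xs) + sum (map G xs)) ≡⟨ +-interchange (F x) (G x) _ _ ⟩
    (F x + sum (map F xs)) + (G x + sum (map G xs)) ∎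
    where open ≡-Reasoning

  sum-map-≤-* : ∀ {F : A → ℕ} {B} (xs : List A) → (∀ x → F x ≤ B) → sum (map F xs) ≤ length xs * B
  sum-map-≤-* []       _   = z≤n
  sum-map-≤-* (x ∷ xs) F≤B = +-mono-≤ (F≤B x) (sum-map-≤-* xs F≤B)

sum-tabulate-single : ∀ {l} (F : Fin l → ℕ) q {B} → (∀ i → toℕ i ≢ q → F i ≡ 0) → (∀ i → F i ≤ B) →
                      sum (tabulate F) ≤ B
sum-tabulate-single {zero}  F q       _    _   = z≤n
sum-tabulate-single {suc l} F zero    F≡0 F≤B =
  ≤-trans (+-mono-≤ (F≤B zero) rest≤0) (≤-reflexive (+-identityʳ _))
  where
  rest≤0 : sum (tabulate (F ∘ suc)) ≤ 0
  rest≤0 = sum-tabulate-single (F ∘ suc) zero (λ i _ → F≡0 (suc i) λ ())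
                                               (λ i → ≤-reflexive (F≡0 (suc i) λ ()))
sum-tabulate-single {suc l} F (suc q) F≡0 F≤B rewrite F≡0 zero (λ ()) =
  sum-tabulate-single (F ∘ suc) q (λ i i≢q → F≡0 (suc i) (i≢q ∘ suc-injective)) (F≤B ∘ suc)

sum-allFin-≤-* : ∀ {l} {F : Fin l → ℕ} {B} → (∀ i → F i ≤ B) → sum (map F (allFin l)) ≤ l * B
sum-allFin-≤-* {l} {F} {B} F≤B =
  subst (λ m → sum (map F (allFin l)) ≤ m * B) (length-tabulate {n = l} id) (sum-map-≤-* (allFin l) F≤B)

∣⋃ᶠ∣≤sum : ∀ {n l} (F : Fin l → Subset n) → ∣ ⋃ᶠ F ∣ ≤ sum (map (∣_∣ ∘ F) (allFin l))
∣⋃ᶠ∣≤sum {n} {l} F = go (allFin l)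
  where
  go : ∀ is → ∣ foldr _∪_ ⊥ (map F is) ∣ ≤ sum (map (∣_∣ ∘ F) is)
  go []       = ≤-reflexive (∣⊥∣≡0 n)
  go (i ∷ is) = ≤-trans (∣p∪q∣≤∣p∣+∣q∣ (F i) _) (+-monoʳ-≤ ∣ F i ∣ (go is))

-- sumRange lo hi f unfolds to the sum of restrict lo hi (pos i) (f i) over all i.
restrict : ℕ → ℕ → ℕ → ℕ → ℕ
restrict lo hi p x = if (lo ≤ᵇ p) ∧ (p <ᵇ hi) then x else 0

restrict-cases : ∀ lo hi p x → (lo ≤ p × p < hi × restrict lo hi p x ≡ x)
                             ⊎ (¬ (lo ≤ p × p < hi) × restrict lo hi p x ≡ 0)
restrict-cases lo hi p x with lo ≤ᵇ p | ≤ᵇ-reflects-≤ lo p | p <ᵇ hi | <ᵇ-reflects-< p hi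
... | true  | ofʸ lo≤p  | true  | ofʸ p<hi  = inj₁ (lo≤p , p<hi , refl)
... | true  | ofʸ _     | false | ofⁿ p≮hi  = inj₂ (p≮hi ∘ proj₂ , refl)
... | false | ofⁿ lo≰p  | _     | _         = inj₂ (lo≰p ∘ proj₁ , refl)

restrict-in : ∀ lo hi p x → lo ≤ p → p < hi → restrict lo hi p x ≡ x
restrict-in lo hi p x lo≤p p<hi with restrict-cases lo hi p x
... | inj₁ (_ , _ , eq)  = eq
... | inj₂ (out , _)     = contradiction (lo≤p , p<hi) out

restrict-out : ∀ lo hi p x → ¬ (lo ≤ p × p < hi) → restrict lo hi p x ≡ 0
restrict-out lo hi p x out with restrict-cases lo hi p x
... | inj₁ (lo≤p , p<hi , _) = contradiction (lo≤p , p<hi) out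
... | inj₂ (_ , eq)          = eq

restrict-≤ : ∀ lo hi p {x B} → (p < hi → x ≤ B) → restrict lo hi p x ≤ B
restrict-≤ lo hi p {x} x≤B with restrict-cases lo hi p x
... | inj₁ (_ , p<hi , eq) = subst (_≤ _) (≡-sym eq) (x≤B p<hi)
... | inj₂ (_ , eq)        = subst (_≤ _) (≡-sym eq) z≤n

restrict-split : ∀ lo mid hi p x → restrict lo hi p x ≤ restrict lo mid p x + restrict mid hi p x
restrict-split lo mid hi p x with restrict-cases lo hi p x | p <? mid
... | inj₂ (_ , eq)             | _         =
  subst (_≤ restrict lo mid p x + restrict mid hi p x) (≡-sym eq) z≤n
... | inj₁ (lo≤p , p<hi , eq) | yes p<mid =
  subst₂ _≤_ (≡-sym eq) (cong (_+ _) (≡-sym (restrict-in lo mid p x lo≤p p<mid))) (m≤m+n x _)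
... | inj₁ (lo≤p , p<hi , eq) | no  p≮mid =
  subst₂ _≤_ (≡-sym eq) (cong (_ +_) (≡-sym (restrict-in mid hi p x (≮⇒≥ p≮mid) p<hi))) (m≤n+m x _)

module _ {l : ℕ} (f : Fin l → ℕ) where

  private
    term : ℕ → ℕ → Fin l → ℕ
    term lo hi i = restrict lo hi (pos i) (f i)

  sumRange-split : ∀ lo mid hi → sumRange lo hi f ≤ sumRange lo mid f + sumRange mid hi f
  sumRange-split lo mid hi = ≤-trans
    (sum-map-mono {F = term lo hi} {G = λ i → term lo mid i + term mid hi i} (allFin l)
                  (λ i → restrict-split lo mid hi (pos i) (f i)))
    (≤-reflexive (sum-map-+ (term lo mid) (term mid hi) (allFin l)))

  sumRange-≤-* : ∀ lo hi {B} → (∀ i → pos i < hi → f i ≤ B) → sumRange lo hi f ≤ l * B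
  sumRange-≤-* lo hi f≤B = sum-allFin-≤-* {F = term lo hi} (λ i → restrict-≤ lo hi (pos i) (f≤B i))

  sumRange-empty : ∀ p → sumRange p p f ≡ 0
  sumRange-empty p = n≤0⇒n≡0 (≤-trans
    (sum-map-≤-* {F = term p p} (allFin l) λ i →
      ≤-reflexive (restrict-out p p (pos i) (f i) λ (p≤pos , pos<p) → <⇒≱ pos<p p≤pos))
    (≤-reflexive (*-zeroʳ (length (allFin l)))))

  sumRange-single : ∀ p {B} → (∀ i → f i ≤ B) → sumRange p (suc p) f ≤ B
  sumRange-single p {B} f≤B = subst (_≤ B) (cong sum (≡-sym (map-tabulate id (term p (suc p)))))
    (sum-tabulate-single (term p (suc p)) (pred p) vanish λ i → restrict-≤ p (suc p) (pos i) (λ _ → f≤B i))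
    where
    vanish : ∀ i → toℕ i ≢ pred p → restrict p (suc p) (pos i) (f i) ≡ 0
    vanish i i≢ = restrict-out p (suc p) (pos i) (f i) λ (p≤pos , pos<sp) →
      i≢ (cong pred (≤-antisym (≤-pred pos<sp) p≤pos))

  sum≤sumRange : sum (map f (allFin l)) ≤ sumRange 1 (suc l) f
  sum≤sumRange = sum-map-mono {G = term 1 (suc l)} (allFin l) λ i →
    ≤-reflexive (≡-sym (restrict-in 1 (suc l) (pos i) (f i) (s≤s z≤n) (s≤s (toℕ<n i))))

last-crossing : ∀ (g : ℕ → ℕ) D m → g (suc m) < D →
                g 1 < D ⊎ ∃[ p ] (1 ≤ p × p ≤ m × D ≤ g p × g (suc p) < D)
last-crossing g D zero    g1<D = inj₁ g1<D
last-crossing g D (suc m) gm<D with D ≤? g (suc m)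
... | yes D≤gm = inj₂ (suc m , s≤s z≤n , ≤-refl , D≤gm , gm<D)
... | no  D≰gm with last-crossing g D m (≰⇒> D≰gm)
...   | inj₁ g1<D                    = inj₁ g1<D
...   | inj₂ (p , 1≤p , p≤m , D≤gp , gp<D) = inj₂ (p , 1≤p , m≤n⇒m≤1+n p≤m , D≤gp , gp<D)

module _ {l} (f : Fin l → ℕ) {T D : ℕ} (D>0 : 0 < D) (f≤T : ∀ i → f i ≤ T) where

  private
    empty<D : ∀ p → sumRange p p f < D
    empty<D p = subst (_< D) (≡-sym (sumRange-empty f p)) D>0

    segment≤ : ∀ p hi → sumRange (suc p) hi f < D → sumRange p hi f ≤ T + D
    segment≤ p hi rest<D = ≤-trans (sumRange-split f p (suc p) hi)
                                   (+-mono-≤ (sumRange-single f p f≤T) (<⇒≤ rest<D))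

  sumRange-thresholds : ∀ {B} →
    (∀ a b → 1 ≤ a → a ≤ l → 1 ≤ b → b ≤ l →
       D ≤ sumRange a (suc l) f → D ≤ sumRange b a f → ∀ i → pos i < b → f i ≤ B) →
    sumRange 1 (suc l) f ≤ l * B + ((T + D) + (T + D))
  sumRange-thresholds {B} small with last-crossing (λ a → sumRange a (suc l) f) D l (empty<D (suc l))
  ... | inj₁ total<D = ≤-trans (<⇒≤ total<D)
                         (≤-trans (m≤n+m D T) (≤-trans (m≤m+n (T + D) (T + D)) (m≤n+m _ (l * B))))
  ... | inj₂ (zero  , () , _)
  ... | inj₂ (suc a , _ , a<l , D≤tail , tail'<D)
    with last-crossing (λ b → sumRange b (suc a) f) D a (empty<D (suc a))
  ...   | inj₁ head<D = begin
          sumRange 1 (suc l) f                                ≤⟨ sumRange-split f 1 (suc a) (suc l) ⟩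
          sumRange 1 (suc a) f + sumRange (suc a) (suc l) f
            ≤⟨ +-mono-≤ (<⇒≤ head<D) (segment≤ (suc a) (suc l) tail'<D) ⟩
          D + (T + D)                                         ≤⟨ +-monoˡ-≤ (T + D) (m≤n+m D T) ⟩
          (T + D) + (T + D)                                   ≤⟨ m≤n+m _ (l * B) ⟩
          l * B + ((T + D) + (T + D))                         ∎
    where open ≤-Reasoning
  ...   | inj₂ (b , 1≤b , b≤a , D≤mid , mid'<D) = begin
          sumRange 1 (suc l) f                                ≤⟨ sumRange-split f 1 b (suc l) ⟩
          sumRange 1 b f + sumRange b (suc l) f
            ≤⟨ +-monoʳ-≤ (sumRange 1 b f) (sumRange-split f b (suc a) (suc l)) ⟩
          sumRange 1 b f + (sumRange b (suc a) f + sumRange (suc a) (suc l) f)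
            ≤⟨ +-mono-≤ head≤ (+-mono-≤ (segment≤ b (suc a) mid'<D) (segment≤ (suc a) (suc l) tail'<D)) ⟩
          l * B + ((T + D) + (T + D))                         ∎
    where
    open ≤-Reasoning
    head≤ : sumRange 1 b f ≤ l * B
    head≤ = sumRange-≤-* f 1 b
      (small (suc a) b (s≤s z≤n) a<l 1≤b (≤-trans (m≤n⇒m≤1+n b≤a) a<l) D≤tail D≤mid)

module _ {n : ℕ} (G : Graph n) where

  Edge-sym : ∀ {u v} → Edge G u v → Edge G v u
  Edge-sym {u} {v} = trans (sym G v u)

  NonEdge-sym : ∀ {u v} → NonEdge G u v → NonEdge G v u
  NonEdge-sym {u} {v} = trans (sym G v u)

  Edge⇒≢ : ∀ {u v} → Edge G u v → u ≢ v
  Edge⇒≢ {u} uv refl with () ← trans (≡-sym uv) (irrefl G u)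

  ¬Edge⇒NonEdge : ∀ {u v} → ¬ Edge G u v → NonEdge G u v
  ¬Edge⇒NonEdge {u} {v} ¬uv with adj G u v
  ... | true  = contradiction refl ¬uv
  ... | false = refl

  ClosedAdj-sym : ∀ {u v} → ClosedAdj G u v → ClosedAdj G v u
  ClosedAdj-sym (inj₁ u≡v) = inj₁ (≡-sym u≡v)
  ClosedAdj-sym (inj₂ uv)  = inj₂ (Edge-sym uv)

  ClosedAdj⇒Edge : ∀ {u v} → ClosedAdj G u v → u ≢ v → Edge G u v
  ClosedAdj⇒Edge (inj₁ u≡v) u≢v = contradiction u≡v u≢v
  ClosedAdj⇒Edge (inj₂ uv)  _   = uv

  ClosedAdj? : ∀ u → Decidable (ClosedAdj G u)
  ClosedAdj? u v = (u ≟ᶠ v) ⊎-dec (adj G u v ≟ᵇ true)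

  N[_] : Fin n → Subset n
  N[ u ] = fromDec (ClosedAdj? u)

  ∈N⁺ : ∀ {u v} → ClosedAdj G u v → v ∈ N[ u ]
  ∈N⁺ {u} = ∈-fromDec⁺ (ClosedAdj? u)

  ∈N⁻ : ∀ {u v} → v ∈ N[ u ] → ClosedAdj G u v
  ∈N⁻ {u} = ∈-fromDec⁻ (ClosedAdj? u)

  degreeIn : Subset n → Fin n → ℕ
  degreeIn S v = ∣ S ∩ N[ v ] ∣

  universalIn : Subset n → Subset n
  universalIn S = fromDec (λ v → S ⊆? N[ v ])

  ∈universalIn⁻ : ∀ {S v} → v ∈ universalIn S → S ⊆ N[ v ]
  ∈universalIn⁻ {S} = ∈-fromDec⁻ (λ v → S ⊆? N[ v ])

  ∈universalIn⁺ : ∀ {S v} → S ⊆ N[ v ] → v ∈ universalIn S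
  ∈universalIn⁺ {S} = ∈-fromDec⁺ (λ v → S ⊆? N[ v ])

  TriviallyPerfectOn-⊆ : ∀ {X S} → X ⊆ S → TriviallyPerfectOn G S → TriviallyPerfectOn G X
  TriviallyPerfectOn-⊆ X⊆S tp a b c d a∈ b∈ c∈ d∈ = tp a b c d (X⊆S a∈) (X⊆S b∈) (X⊆S c∈) (X⊆S d∈)

  IsModule-∩ : ∀ {S} P → IsModule G S →
    (∀ u v w → u ∈ S ∩ P → v ∈ S ∩ P → w ∈ S → w ∉ P → adj G u w ≡ adj G v w) →
    IsModule G (S ∩ P)
  IsModule-∩ {S} P mod uniform u v w u∈ v∈ w∉ with w ∈? S | w ∈? P
  ... | no  w∉S | _       = mod u v w (p∩q⊆p S P u∈) (p∩q⊆p S P v∈) w∉S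
  ... | yes w∈S | no  w∉P = uniform u v w u∈ v∈ w∈S w∉P
  ... | yes w∈S | yes w∈P = contradiction (x∈p∩q⁺ (w∈S , w∈P)) w∉

  universal-twins : ∀ {S} → IsModule G S → TwinSet G (S ∩ universalIn S)
  universal-twins {S} mod u v u∈ v∈ w = transfer u∈ v∈ , transfer v∈ u∈
    where
    transfer : ∀ {a b} → a ∈ S ∩ universalIn S → b ∈ S ∩ universalIn S → ClosedAdj G a w → ClosedAdj G b w
    transfer {a} {b} a∈ b∈ aw with w ∈? S
    ... | yes w∈S = ∈N⁻ (∈universalIn⁻ (p∩q⊆q S _ b∈) w∈S)
    ... | no  w∉S = inj₂ (trans (mod b a w (p∩q⊆p S _ b∈) (p∩q⊆p S _ a∈) w∉S)
                                (ClosedAdj⇒Edge aw λ { refl → w∉S (p∩q⊆p S _ a∈) }))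

  nonUniversal : Subset n → Subset n
  nonUniversal S = S ∩ ∁ (universalIn S)

  universal⇒Edge : ∀ {S u w} → u ∈ nonUniversal S → w ∈ universalIn S → Edge G u w
  universal⇒Edge {S} u∈ w∈U = Edge-sym (ClosedAdj⇒Edge (∈N⁻ (∈universalIn⁻ w∈U (p∩q⊆p S _ u∈)))
    λ { refl → x∈∁p⇒x∉p (p∩q⊆q S _ u∈) w∈U })

  nonUniversal-module : ∀ {S} → IsModule G S → IsModule G (nonUniversal S)
  nonUniversal-module {S} mod = IsModule-∩ (∁ (universalIn S)) mod λ u v w u∈ v∈ _ w∉∁U →
    let w∈U = x∉∁p⇒x∈p w∉∁U in trans (universal⇒Edge u∈ w∈U) (≡-sym (universal⇒Edge v∈ w∈U))

  nonUniversal-nonNeighbour : ∀ {S v} → v ∈ nonUniversal S → ∃[ w ] (w ∈ nonUniversal S × w ∉ N[ v ])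
  nonUniversal-nonNeighbour {S} {v} v∈S′ with ⊈⇒∃∉ (x∈∁p⇒x∉p (p∩q⊆q S _ v∈S′) ∘ ∈universalIn⁺)
  ... | w , w∈S , w∉Nv = w , x∈p∩q⁺ (w∈S , x∉p⇒x∈∁p w∉U) , w∉Nv
    where
    w∉U : w ∉ universalIn S
    w∉U w∈U = w∉Nv (∈N⁺ (ClosedAdj-sym (∈N⁻ (∈universalIn⁻ w∈U (p∩q⊆p S _ v∈S′)))))

  IsModule-split : ∀ {S} P → IsModule G S → (∀ x y → x ∈ S ∩ P → y ∈ S ∩ ∁ P → NonEdge G x y) →
                   IsModule G (S ∩ P) × IsModule G (S ∩ ∁ P)
  IsModule-split {S} P mod cross =
    IsModule-∩ P mod (λ u v w u∈ v∈ w∈S w∉P →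
      let w∈ = x∈p∩q⁺ (w∈S , x∉p⇒x∈∁p w∉P) in trans (cross u w u∈ w∈) (≡-sym (cross v w v∈ w∈))) ,
    IsModule-∩ (∁ P) mod (λ u v w u∈ v∈ w∈S w∉∁P →
      let w∈ = x∈p∩q⁺ (w∈S , x∉∁p⇒x∈p w∉∁P) in
      trans (NonEdge-sym (cross w u w∈ u∈)) (≡-sym (NonEdge-sym (cross w v w∈ v∈))))

  Independent-∪ : ∀ {I J} → Independent G I → Independent G J →
                  (∀ x y → x ∈ I → y ∈ J → NonEdge G x y) → Independent G (I ∪ J)
  Independent-∪ {I} {J} indI indJ cross x y x∈ y∈ with x∈p∪q⁻ I J x∈ | x∈p∪q⁻ I J y∈
  ... | inj₁ x∈I | inj₁ y∈I = indI x y x∈I y∈I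
  ... | inj₂ x∈J | inj₂ y∈J = indJ x y x∈J y∈J
  ... | inj₁ x∈I | inj₂ y∈J = cross x y x∈I y∈J
  ... | inj₂ x∈J | inj₁ y∈I = NonEdge-sym (cross y x y∈I x∈J)

  TriviallyPerfectOn⇒¬path : ∀ {S z v x y} → TriviallyPerfectOn G S → z ∈ S → v ∈ S → x ∈ S → y ∈ S →
    z ≢ x → z ≢ y → v ≢ y → Edge G z v → Edge G v x → Edge G x y → NonEdge G z x → NonEdge G v y → ⊥-type
  TriviallyPerfectOn⇒¬path {z = z} {y = y} tp z∈ v∈ x∈ y∈ z≢x z≢y v≢y zv vx xy zx vy with adj G z y in zy
  ... | true  = proj₂ (tp _ _ _ _ z∈ v∈ x∈ y∈)
    (Edge⇒≢ zv , z≢x , z≢y , Edge⇒≢ vx , v≢y , Edge⇒≢ xy , zv , vx , xy , Edge-sym zy , zx , vy)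
  ... | false = proj₁ (tp _ _ _ _ z∈ v∈ x∈ y∈)
    (Edge⇒≢ zv , z≢x , z≢y , Edge⇒≢ vx , v≢y , Edge⇒≢ xy , zv , vx , xy , zx , vy , zy)

  maxDegree-separates : ∀ {S v} → TriviallyPerfectOn G S → v ∈ S →
    (∀ {y} → y ∈ S → degreeIn S y ≤ degreeIn S v) →
    ∀ {x y} → x ∈ S → y ∈ S → x ∈ N[ v ] → y ∉ N[ v ] → NonEdge G x y
  maxDegree-separates {S} {v} tp v∈S max {x} {y} x∈S y∈S x∈Nv y∉Nv = ¬Edge⇒NonEdge no-edge
    where
    Nv⊈Nx : Edge G x y → ¬ S ∩ N[ v ] ⊆ S ∩ N[ x ]
    Nv⊈Nx xy Nv⊆Nx = <⇒≱ (p⊂q⇒∣p∣<∣q∣ (Nv⊆Nx , y , x∈p∩q⁺ (y∈S , ∈N⁺ (inj₂ xy)) , y∉Nv ∘ p∩q⊆q S _))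
                         (max x∈S)
    no-edge : ¬ Edge G x y
    no-edge xy with ⊈⇒∃∉ (Nv⊈Nx xy)
    ... | z , z∈ , z∉ = TriviallyPerfectOn⇒¬path tp z∈S v∈S x∈S y∈S z≢x z≢y v≢y (Edge-sym vz) vx xy zx vy
      where
      vx : Edge G v x
      vx = ClosedAdj⇒Edge (∈N⁻ x∈Nv) λ { refl → y∉Nv (∈N⁺ (inj₂ xy)) }
      v≢y : v ≢ y
      v≢y v≡y = y∉Nv (∈N⁺ (inj₁ v≡y))
      vy : NonEdge G v y
      vy = ¬Edge⇒NonEdge (y∉Nv ∘ ∈N⁺ ∘ inj₂)
      z∈S : z ∈ S
      z∈S = p∩q⊆p S _ z∈
      z∈Nv : z ∈ N[ v ]
      z∈Nv = p∩q⊆q S _ z∈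
      z∉Nx : z ∉ N[ x ]
      z∉Nx z∈Nx = z∉ (x∈p∩q⁺ (z∈S , z∈Nx))
      z≢x : z ≢ x
      z≢x refl = z∉Nx (∈N⁺ (inj₁ refl))
      z≢y : z ≢ y
      z≢y refl = y∉Nv z∈Nv
      vz : Edge G v z
      vz = ClosedAdj⇒Edge (∈N⁻ z∈Nv) λ { refl → z∉Nx (∈N⁺ (ClosedAdj-sym (∈N⁻ x∈Nv))) }
      zx : NonEdge G z x
      zx = NonEdge-sym (¬Edge⇒NonEdge (z∉Nx ∘ ∈N⁺ ∘ inj₂))

  module _ {K : ℕ} (twins≤K : ∀ X → TwinSet G X → ∣ X ∣ ≤ K) where

    -- The summand K on the left pays for the universal vertices split off in each induction step.
    IndependentBound : Subset n → Set
    IndependentBound S = ∃[ I ] (I ⊆ S × Independent G I × ∣ S ∣ + K ≤ ∣ I ∣ * (K + K))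

    IndependentBound-small : ∀ {S x} → x ∈ S → ∣ S ∣ ≤ K → IndependentBound S
    IndependentBound-small {S} {x} x∈S ∣S∣≤K =
      ⁅ x ⁆ , singleton⊆ , singleton-independent , (begin
        ∣ S ∣ + K         ≤⟨ +-monoˡ-≤ K ∣S∣≤K ⟩
        K + K             ≡⟨ ≡-sym (*-identityˡ (K + K)) ⟩
        1 * (K + K)       ≡⟨ cong (_* (K + K)) (≡-sym (∣⁅x⁆∣≡1 x)) ⟩
        ∣ ⁅ x ⁆ ∣ * (K + K) ∎)
      where
      open ≤-Reasoning
      singleton⊆ : ⁅ x ⁆ ⊆ S
      singleton⊆ y∈ = subst (_∈ S) (≡-sym (x∈⁅y⁆⇒x≡y x y∈)) x∈S
      singleton-independent : Independent G ⁅ x ⁆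
      singleton-independent u v u∈ v∈ rewrite x∈⁅y⁆⇒x≡y x u∈ | x∈⁅y⁆⇒x≡y x v∈ = irrefl G x

    ∣S∣≤K+∣nonUniversal∣ : ∀ {S} → IsModule G S → ∣ S ∣ ≤ K + ∣ nonUniversal S ∣
    ∣S∣≤K+∣nonUniversal∣ {S} mod = begin
      ∣ S ∣                                      ≡⟨ ≡-sym (∣p∩q∣+∣p∩∁q∣≡∣p∣ S (universalIn S)) ⟩
      ∣ S ∩ universalIn S ∣ + ∣ nonUniversal S ∣ ≤⟨ +-monoˡ-≤ _ (twins≤K _ (universal-twins mod)) ⟩
      K + ∣ nonUniversal S ∣                     ∎
      where open ≤-Reasoning

    IndependentBound-combine : ∀ {S A B} → ∣ S ∣ ≤ K + (∣ A ∣ + ∣ B ∣) → A ⊆ S → B ⊆ S →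
      (∀ {x} → x ∈ A → x ∉ B) → (∀ x y → x ∈ A → y ∈ B → NonEdge G x y) →
      IndependentBound A → IndependentBound B → IndependentBound S
    IndependentBound-combine {S} {A} {B} ∣S∣≤ A⊆S B⊆S disjoint cross
                             (I , I⊆A , indI , boundA) (J , J⊆B , indJ , boundB) =
      I ∪ J , I∪J⊆S , Independent-∪ indI indJ (λ x y x∈I y∈J → cross x y (I⊆A x∈I) (J⊆B y∈J)) , (begin
        ∣ S ∣ + K                       ≤⟨ +-monoˡ-≤ K ∣S∣≤ ⟩
        K + (∣ A ∣ + ∣ B ∣) + K         ≡⟨ rearrange K ∣ A ∣ ∣ B ∣ ⟩
        (∣ A ∣ + K) + (∣ B ∣ + K)       ≤⟨ +-mono-≤ boundA boundB ⟩
        ∣ I ∣ * (K + K) + ∣ J ∣ * (K + K) ≡⟨ ≡-sym (*-distribʳ-+ (K + K) ∣ I ∣ ∣ J ∣) ⟩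
        (∣ I ∣ + ∣ J ∣) * (K + K)       ≤⟨ *-monoˡ-≤ (K + K) (∣p∣+∣q∣≤∣p∪q∣ I J I∩J-empty) ⟩
        ∣ I ∪ J ∣ * (K + K)             ∎)
      where
      open ≤-Reasoning
      rearrange : ∀ k a b → k + (a + b) + k ≡ (a + k) + (b + k)
      rearrange = solve-∀
      I∩J-empty : Empty (I ∩ J)
      I∩J-empty (x , x∈I∩J) = disjoint (I⊆A (p∩q⊆p I J x∈I∩J)) (J⊆B (p∩q⊆q I J x∈I∩J))
      I∪J⊆S : I ∪ J ⊆ S
      I∪J⊆S x∈ with x∈p∪q⁻ I J x∈
      ... | inj₁ x∈I = A⊆S (I⊆A x∈I)
      ... | inj₂ x∈J = B⊆S (J⊆B x∈J)

    tpModule-independentBound : ∀ {S} → TPModule G S → Nonempty S → IndependentBound S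
    tpModule-independentBound {S} = go S (⊂-wellFounded S)
      where
      go : ∀ S → Acc _⊂_ S → TPModule G S → Nonempty S → IndependentBound S
      go S (acc rec) (mod , tp) (x , x∈S) with argmax (degreeIn (nonUniversal S)) (nonUniversal S)
      ... | inj₁ S′-empty = IndependentBound-small x∈S (begin
        ∣ S ∣                       ≤⟨ ∣S∣≤K+∣nonUniversal∣ mod ⟩
        K + ∣ nonUniversal S ∣      ≡⟨ cong (λ X → K + ∣ X ∣) (Empty-unique S′-empty) ⟩
        K + ∣ ⊥ {n} ∣               ≡⟨ cong (K +_) (∣⊥∣≡0 n) ⟩
        K + 0                       ≡⟨ +-identityʳ K ⟩
        K                           ∎)
        where open ≤-Reasoning
      ... | inj₂ (v , v∈S′ , max) with nonUniversal-nonNeighbour v∈S′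
      ...   | w , w∈S′ , w∉Nv =
        IndependentBound-combine size A⊆S B⊆S A∩B-empty cross
          (go A (rec A⊂S) (modA , TriviallyPerfectOn-⊆ A⊆S tp) (v , v∈A))
          (go B (rec B⊂S) (modB , TriviallyPerfectOn-⊆ B⊆S tp) (w , w∈B))
        where
        S′ A B : Subset n
        S′ = nonUniversal S
        A = S′ ∩ N[ v ]
        B = S′ ∩ ∁ N[ v ]
        S′⊆S : S′ ⊆ S
        S′⊆S = p∩q⊆p S _
        A⊆S : A ⊆ S
        A⊆S = S′⊆S ∘ p∩q⊆p S′ _
        B⊆S : B ⊆ S
        B⊆S = S′⊆S ∘ p∩q⊆p S′ _
        v∈A : v ∈ A
        v∈A = x∈p∩q⁺ (v∈S′ , ∈N⁺ (inj₁ refl))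
        w∈B : w ∈ B
        w∈B = x∈p∩q⁺ (w∈S′ , x∉p⇒x∈∁p w∉Nv)
        A⊂S : A ⊂ S
        A⊂S = A⊆S , w , S′⊆S w∈S′ , w∉Nv ∘ p∩q⊆q S′ _
        A∩B-empty : ∀ {x} → x ∈ A → x ∉ B
        A∩B-empty x∈A x∈B = x∈∁p⇒x∉p (p∩q⊆q S′ _ x∈B) (p∩q⊆q S′ _ x∈A)
        B⊂S : B ⊂ S
        B⊂S = B⊆S , v , S′⊆S v∈S′ , A∩B-empty v∈A
        cross : ∀ x y → x ∈ A → y ∈ B → NonEdge G x y
        cross x y x∈A y∈B = maxDegree-separates (TriviallyPerfectOn-⊆ S′⊆S tp) v∈S′ max
          (p∩q⊆p S′ _ x∈A) (p∩q⊆p S′ _ y∈B) (p∩q⊆q S′ _ x∈A) (x∈∁p⇒x∉p (p∩q⊆q S′ _ y∈B))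
        modA×modB : IsModule G A × IsModule G B
        modA×modB = IsModule-split N[ v ] (nonUniversal-module mod) cross
        modA : IsModule G A
        modA = proj₁ modA×modB
        modB : IsModule G B
        modB = proj₂ modA×modB
        size : ∣ S ∣ ≤ K + (∣ A ∣ + ∣ B ∣)
        size = subst (λ m → ∣ S ∣ ≤ K + m) (≡-sym (∣p∩q∣+∣p∩∁q∣≡∣p∣ S′ N[ v ]))
                     (∣S∣≤K+∣nonUniversal∣ mod)

partSize threshold : ℕ → ℕ
partSize  k = (2 * k + 5) * (suc k + suc k)
threshold k = 2 * k + 1

module _ {n : ℕ} (G : Graph n) (k : ℕ) where

  tpModule-size : Rule2-reduced G k → Rule3-reduced G k →
                  ∀ {S} → TPModule G S → Nonempty S → ∣ S ∣ ≤ partSize k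
  tpModule-size r2 r3 {S} tpm ne with tpModule-independentBound G r2 tpm ne
  ... | I , I⊆S , indI , bound with 2 * k + 5 ≤? ∣ I ∣
  ...   | yes big with ⊆-ofSize I (2 * k + 5) big
  ...     | J , J⊆I , ∣J∣≡ = begin
            ∣ S ∣     ≤⟨ p⊆q⇒∣p∣≤∣q∣ (r3 S J tpm (I⊆S ∘ J⊆I) indJ (≤-reflexive (≡-sym ∣J∣≡))) ⟩
            ∣ J ∣     ≡⟨ ∣J∣≡ ⟩
            2 * k + 5 ≤⟨ m≤m*n (2 * k + 5) (suc k + suc k) ⟩
            partSize k ∎
    where
    open ≤-Reasoning
    indJ : Independent G J
    indJ u v u∈ v∈ = indI u v (J⊆I u∈) (J⊆I v∈)
  tpModule-size r2 r3 {S} tpm ne | I , I⊆S , indI , bound | no small = begin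
    ∣ S ∣                     ≤⟨ m≤m+n ∣ S ∣ (suc k) ⟩
    ∣ S ∣ + suc k             ≤⟨ bound ⟩
    ∣ I ∣ * (suc k + suc k)   ≤⟨ *-monoˡ-≤ (suc k + suc k) (<⇒≤ (≰⇒> small)) ⟩
    partSize k                ∎
    where open ≤-Reasoning

  module _ (cb : Comb G) where

    comb-length≤ : Rule4-reduced G k → len cb ≤ 2 * k + 2
    comb-length≤ r4 with len cb ≤? 2 * k + 2
    ... | yes l≤ = l≤
    ... | no  l≰ = contradiction x∈Cᵢ (proj₁ (r4 cb (<⇒≤ l>) i x pos>))
      where
      l> : 2 * k + 2 < len cb
      l> = ≰⇒> l≰
      i : Fin (len cb)
      i = fromℕ< l>
      x : Fin n
      x = proj₁ (proj₁ (Cp-crit cb i))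
      x∈Cᵢ : x ∈ Cp cb i
      x∈Cᵢ = proj₂ (proj₁ (Cp-crit cb i))
      pos> : 2 * k + 2 < pos i
      pos> = s≤s (≤-reflexive (≡-sym (toℕ-fromℕ< l>)))

    ∣C∣≤ : Rule2-reduced G k → ∣ C cb ∣ ≤ len cb * suc k
    ∣C∣≤ r2 = ≤-trans (∣⋃ᶠ∣≤sum (Cp cb)) (sum-allFin-≤-* λ i → r2 (Cp cb i) (proj₁ (proj₂ (Cp-crit cb i))))

    ∣R∣≤ : Rule2-reduced G k → Rule3-reduced G k → Rule5-reduced G k →
           ∣ R cb ∣ ≤ len cb * suc k + ((partSize k + threshold k) + (partSize k + threshold k))
    ∣R∣≤ r2 r3 r5 = ≤-trans (∣⋃ᶠ∣≤sum (Rp cb)) (≤-trans (sum≤sumRange ∣Rᵢ∣)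
      (sumRange-thresholds ∣Rᵢ∣ (m≤n+m 1 (2 * k)) ∣Rᵢ∣≤ λ a b 1≤a a≤l 1≤b b≤l tail mid i i<b →
        proj₂ (r5 cb a b 1≤a a≤l 1≤b b≤l tail mid i i<b)))
      where
      ∣Rᵢ∣ : Fin (len cb) → ℕ
      ∣Rᵢ∣ i = ∣ Rp cb i ∣
      ∣Rᵢ∣≤ : ∀ i → ∣Rᵢ∣ i ≤ partSize k
      ∣Rᵢ∣≤ i = tpModule-size r2 r3 (Rp-tpm cb i) (Rp-nonempty cb i)

lemma15 : ∃[ c ] (∀ (n : ℕ) (G : Graph n) (k : ℕ) → Reduced G k →
            ∀ (cb : Comb G) → ∣ CR G cb ∣ ≤ c * (suc k) ^ 2)
lemma15 = 26 , λ n G k (r2 , r3 , r4 , r5) cb → let l≤ = comb-length≤ G k cb r4 in begin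
  ∣ CR G cb ∣                                         ≤⟨ ∣p∪q∣≤∣p∣+∣q∣ (C cb) (R cb) ⟩
  ∣ C cb ∣ + ∣ R cb ∣                                 ≤⟨ +-mono-≤ (∣C∣≤ G k cb r2) (∣R∣≤ G k cb r2 r3 r5) ⟩
  len cb * suc k + (len cb * suc k + slack k)
    ≤⟨ +-mono-≤ (*-monoˡ-≤ (suc k) l≤) (+-monoˡ-≤ (slack k) (*-monoˡ-≤ (suc k) l≤)) ⟩
  (2 * k + 2) * suc k + ((2 * k + 2) * suc k + slack k) ≤⟨ m≤m+n _ (14 * k * k + 12 * k) ⟩
  (2 * k + 2) * suc k + ((2 * k + 2) * suc k + slack k) + (14 * k * k + 12 * k) ≡⟨ arithmetic k ⟩
  26 * suc k ^ 2                                      ∎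
  where
  open ≤-Reasoning
  slack : ℕ → ℕ
  slack k = (partSize k + threshold k) + (partSize k + threshold k)
  -- The right-hand side is suc k ^ 2 unfolded, since the ring solver does not handle _^_.
  arithmetic : ∀ k →
    (2 * k + 2) * suc k + ((2 * k + 2) * suc k + (((2 * k + 5) * (suc k + suc k) + (2 * k + 1))
                                                + ((2 * k + 5) * (suc k + suc k) + (2 * k + 1))))
    + (14 * k * k + 12 * k) ≡ 26 * (suc k * (suc k * 1))
  arithmetic = solve-∀
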